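{- Let $G$ and $H$ be finite bipartite graphs of diameter at most $2$ (in particular connected). If $|\mathrm{Hom}(G,T)| = |\mathrm{Hom}(H,T)|$ for every finite tree $T$, then $G$ and $H$ are isomorphic.
   Context: All graphs are finite, simple and undirected. $\mathrm{Hom}(G,H)$ denotes the set of graph homomorphisms from $G$ to $H$. A tree is a connected graph with no cycles. The diameter of a graph is the least $p$ such that any two distinct vertices are joined by a path of length at most $p$ (it is $\infty$ for disconnected graphs). -}

module Defs where

open import Data.Nat using (ℕ; zero; suc; _≥_)
open import Data.Bool using (Bool; true; false; _∧_)
open import Data.Fin using (Fin)
open import Data.List using (List; []; _∷_; length; map; filter; concatMap; allFin)
open import Data.Product using (Σ; _×_; ∃; ∃-syntax; _,_)
open import Data.Sum using (_⊎_)
open import Relation.Binary.PropositionalEquality using (_≡_)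
open import Relation.Nullary using (¬_)
open import Function.Bundles using (_↔_; Inverse)
open import Data.List.Relation.Unary.AllPairs using (AllPairs)
open import Data.List.Relation.Unary.Unique.Propositional using (Unique)

record Graph : Set where
  field
    n      : ℕ
    adj    : Fin n → Fin n → Bool
    sym    : ∀ u v → adj u v ≡ adj v u
    irrefl : ∀ u → adj u u ≡ false
open Graph public

Edge : (G : Graph) → Fin (n G) → Fin (n G) → Set
Edge G u v = adj G u v ≡ true

IsHom : (G H : Graph) → (Fin (n G) → Fin (n H)) → Set
IsHom G H f = ∀ u v → Edge G u v → Edge H (f u) (f v)

allB : ∀ {k} → (Fin k → Bool) → Bool
allB {k} p = Data.List.foldr (λ i b → p i ∧ b) true (allFin k)

isHomB : (G H : Graph) → (Fin (n G) → Fin (n H)) → Bool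
isHomB G H f =
  allB (λ u → allB (λ v → implies (adj G u v) (adj H (f u) (f v))))
  where
  implies : Bool → Bool → Bool
  implies true  b = b
  implies false _ = true

allFuns : (k m : ℕ) → List (Fin k → Fin m)
allFuns zero    m = (λ ()) ∷ []
allFuns (suc k) m =
  concatMap (λ i → map (λ f → λ { Fin.zero → i ; (Fin.suc x) → f x }) (allFuns k m))
            (allFin m)

homCount : Graph → Graph → ℕ
homCount G H = length (filter (λ f → Data.Bool._≟_ (isHomB G H f) true) (allFuns (n G) (n H)))

data Walk (G : Graph) : Fin (n G) → Fin (n G) → ℕ → Set where
  here : ∀ {u} → Walk G u u 0
  step : ∀ {u w v : Fin (n G)} {ℓ : ℕ} → Edge G u w → Walk G w v ℓ → Walk G u v (suc ℓ)

Connected : Graph → Set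
Connected G = ∀ u v → Σ ℕ λ ℓ → Walk G u v ℓ

DiamLe2 : Graph → Set
DiamLe2 G = ∀ u v → ¬ (u ≡ v) →
  Edge G u v ⊎ (Σ (Fin (n G)) λ w → Edge G u w × Edge G w v)

Bipartite : Graph → Set
Bipartite G = Σ (Fin (n G) → Bool) λ c → (∀ u v → Edge G u v → ¬ (c u ≡ c v))

-- A cycle: a list of k ≥ 3 distinct vertices v₁ … v_k with v_i ~ v_{i+1} and v_k ~ v₁.
data Path (G : Graph) : List (Fin (n G)) → Set where
  single : ∀ v → Path G (v ∷ [])
  cons   : ∀ {u w : Fin (n G)} {vs : List (Fin (n G))} → Edge G u w → Path G (w ∷ vs) → Path G (u ∷ w ∷ vs)

last : ∀ {A : Set} → A → List A → A
last a []       = a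
last a (b ∷ bs) = last b bs

HasCycle : Graph → Set
HasCycle G = Σ (Fin (n G)) λ v → Σ (List (Fin (n G))) λ vs →
  (Path G (v ∷ vs) × Unique (v ∷ vs) × length vs ≥ 2 × Edge G (last v vs) v)

IsTree : Graph → Set
IsTree T = n T ≥ 1 × Connected T × ¬ HasCycle T

Isomorphic : Graph → Graph → Set
Isomorphic G H = Σ (Fin (n G) ↔ Fin (n H)) λ σ →
  ∀ u v → adj G u v ≡ adj H (Inverse.to σ u) (Inverse.to σ v)

{-# OPTIONS --safe #-}
module Submission where

-- A bipartite graph of diameter at most 2 is complete bipartite, so it is determined up to
-- isomorphism by the unordered pair of its colour-class sizes {a, b}. That pair is read off
-- from homomorphisms into the path P₃ with centre 0: such a homomorphism of a connected
-- bipartite graph sends exactly one colour class to the centre and the other class freely to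
-- the two leaves, so |Hom(G, P₃)| = 2^a + 2^b, and 2^a + 2^b determines {a, b}.

open import Defs hiding (sym)
open import Data.Bool using (Bool; true; false; not; _∧_; _∨_; _xor_; if_then_else_)
open import Data.Bool.Properties using (_≟_; ¬-not; not-¬; not-involutive; xor-same; ∨-zeroʳ; ⇔→≡)
open import Data.Empty using (⊥; ⊥-elim)
open import Data.Fin using (Fin; zero; suc)
open import Data.List using (List; []; _∷_; _++_; map; concatMap; filter; length; foldr; tabulate; allFin)
open import Data.List.Properties using (length-++; filter-++; filter-≐; tabulate-cong)
open import Data.List.Relation.Unary.AllPairs using (_∷_)
open import Data.List.Relation.Unary.All using (_∷_)
open import Data.Nat using (ℕ; zero; suc; _+_; _*_; _^_; _≤_; z≤n; s≤s)
open import Data.Nat.ListAction using (product)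
open import Data.Nat.Logarithm using (⌊log₂_⌋; ⌊log₂[2^n]⌋≡n)
open import Data.Nat.Properties
  using (≤-total; +-comm; +-suc; +-mono-≤; *-identityˡ; *-distribˡ-+; *-cancelˡ-≡; m^n>0; even≢odd; suc-injective)
open import Data.Product using (Σ; _×_; _,_; proj₂; swap)
import Data.Product as Product
open import Data.Sum using (_⊎_; inj₁; inj₂; map₁; map₂)
open import Function using (_∘_; id; mk⇔)
open import Function.Bundles using (_↔_; Inverse; mk↔ₛ′)
open import Function.Properties.Inverse using (↔-sym; ↔-trans)
open import Relation.Binary.PropositionalEquality
  using (_≡_; _≢_; refl; sym; trans; cong; cong₂; subst; subst₂; module ≡-Reasoning)
open import Relation.Nullary using (¬_; does; yes; no)
open import Relation.Nullary.Decidable using (dec-true)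

open Inverse using (to; from; strictlyInverseˡ; strictlyInverseʳ)
open ≡-Reasoning

≢⇒xor≡true : ∀ {a b} → a ≢ b → a xor b ≡ true
≢⇒xor≡true {true}  {true}  a≢b = ⊥-elim (a≢b refl)
≢⇒xor≡true {true}  {false} _   = refl
≢⇒xor≡true {false} {true}  _   = refl
≢⇒xor≡true {false} {false} a≢b = ⊥-elim (a≢b refl)

xor≡true⇒≢ : ∀ {a b} → a xor b ≡ true → a ≢ b
xor≡true⇒≢ {a} a⊕a≡true refl with trans (sym (xor-same a)) a⊕a≡true
... | ()

not-xor-not : ∀ a b → not a xor not b ≡ a xor b
not-xor-not true  b = refl
not-xor-not false b = not-involutive b

xor-cancelʳ : ∀ a b → (a xor b) xor b ≡ a
xor-cancelʳ true  true  = refl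
xor-cancelʳ true  false = refl
xor-cancelʳ false b     = xor-same b

∧≡true⇒ : ∀ {a b} → a ∧ b ≡ true → a ≡ true × b ≡ true
∧≡true⇒ {true} b≡true = refl , b≡true

∧≡false⇒ : ∀ {a b} → a ∧ b ≡ false → a ≡ false ⊎ b ≡ false
∧≡false⇒ {false} _       = inj₁ refl
∧≡false⇒ {true}  b≡false = inj₂ b≡false

∨≡true⇒ : ∀ {a b} → a ∨ b ≡ true → a ≡ true ⊎ b ≡ true
∨≡true⇒ {true}  _      = inj₁ refl
∨≡true⇒ {false} b≡true = inj₂ b≡true

does-≟⇒ : ∀ {a b} → does (a ≟ b) ≡ true → a ≡ b
does-≟⇒ {a} {b} _ with a ≟ b
does-≟⇒ _ | yes a≡b = a≡b

-- Phrased so that homCount G H is definitionally count (isHomB G H) (allFuns (n G) (n H)).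
count : {A : Set} → (A → Bool) → List A → ℕ
count p xs = length (filter (λ x → p x ≟ true) xs)

module _ {A : Set} where

  count-cong : {p q : A → Bool} → (∀ x → p x ≡ q x) → ∀ xs → count p xs ≡ count q xs
  count-cong p≗q xs =
    cong length (filter-≐ _ _ ((λ {x} px → trans (sym (p≗q x)) px) , (λ {x} qx → trans (p≗q x) qx)) xs)

  count-++ : (p : A → Bool) (xs ys : List A) → count p (xs ++ ys) ≡ count p xs + count p ys
  count-++ p xs ys = trans (cong length (filter-++ _ xs ys)) (length-++ (filter _ xs))

  count-∧ : (b : Bool) (p : A → Bool) (xs : List A) → count (λ x → b ∧ p x) xs ≡ (if b then count p xs else 0)
  count-∧ true  p xs       = refl
  count-∧ false p []       = refl
  count-∧ false p (x ∷ xs) = count-∧ false p xs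

  count-∨ : {p q : A → Bool} → (∀ x → p x ≡ true → q x ≡ true → ⊥) →
            ∀ xs → count (λ x → p x ∨ q x) xs ≡ count p xs + count q xs
  count-∨ disjoint [] = refl
  count-∨ {p} {q} disjoint (x ∷ xs) with p x in px | q x in qx
  ... | true  | true  = ⊥-elim (disjoint x px qx)
  ... | true  | false = cong suc (count-∨ disjoint xs)
  ... | false | true  = trans (cong suc (count-∨ disjoint xs)) (sym (+-suc (count p xs) (count q xs)))
  ... | false | false = count-∨ disjoint xs

count-map : {A B : Set} (p : B → Bool) (f : A → B) (xs : List A) → count p (map f xs) ≡ count (p ∘ f) xs
count-map p f []       = refl
count-map p f (x ∷ xs) with p (f x)
... | true  = cong suc (count-map p f xs)
... | false = count-map p f xs

count-concatMap : {A B C : Set} (h : A → B → C) {p : C → Bool} {q : A → Bool} {r : B → Bool} →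
                  (∀ a b → p (h a b) ≡ q a ∧ r b) → ∀ as bs →
                  count p (concatMap (λ a → map (h a) bs) as) ≡ count q as * count r bs
count-concatMap h split [] bs = refl
count-concatMap {C = C} h {p} {q} {r} split (a ∷ as) bs = begin
  count p (map (h a) bs ++ rest)                           ≡⟨ count-++ p (map (h a) bs) rest ⟩
  count p (map (h a) bs) + count p rest                    ≡⟨ cong₂ _+_ row (count-concatMap h split as bs) ⟩
  (if q a then count r bs else 0) + count q as * count r bs ≡⟨ head ⟩
  count q (a ∷ as) * count r bs                            ∎
  where
  rest : List C
  rest = concatMap (λ a → map (h a) bs) as

  row : count p (map (h a) bs) ≡ (if q a then count r bs else 0)
  row = trans (count-map p (h a) bs) (trans (count-cong (split a) bs) (count-∧ (q a) r bs))

  head : (if q a then count r bs else 0) + count q as * count r bs ≡ count q (a ∷ as) * count r bs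
  head with q a
  ... | true  = refl
  ... | false = refl

foldr-∧-tabulate : ∀ {k j} (f : Fin k → Fin j) (p : Fin j → Bool) →
                   foldr (λ i b → p i ∧ b) true (tabulate f) ≡ allB (p ∘ f)
foldr-∧-tabulate {zero}  f p = refl
foldr-∧-tabulate {suc k} f p =
  cong (p (f zero) ∧_) (trans (foldr-∧-tabulate (f ∘ suc) p) (sym (foldr-∧-tabulate suc (p ∘ f))))

allB-suc : ∀ {k} (p : Fin (suc k) → Bool) → allB p ≡ p zero ∧ allB (p ∘ suc)
allB-suc p = cong (p zero ∧_) (foldr-∧-tabulate suc p)

allB⁺ : ∀ {k} {p : Fin k → Bool} → (∀ x → p x ≡ true) → allB p ≡ true
allB⁺ {zero}      _   = refl
allB⁺ {suc k} {p} all = trans (allB-suc p) (cong₂ _∧_ (all zero) (allB⁺ (all ∘ suc)))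

allB⁻ : ∀ {k} {p : Fin k → Bool} → allB p ≡ true → ∀ x → p x ≡ true
allB⁻ {suc k} {p} all with ∧≡true⇒ (trans (sym (allB-suc p)) all)
... | p₀ , pₛ = λ { zero → p₀ ; (suc x) → allB⁻ pₛ x }

allB-counterexample : ∀ {k} {p : Fin k → Bool} → allB p ≡ false → Σ (Fin k) λ x → p x ≡ false
allB-counterexample {suc k} {p} none with ∧≡false⇒ (trans (sym (allB-suc p)) none)
... | inj₁ p₀ = zero , p₀
... | inj₂ pₛ = Product.map suc id (allB-counterexample pₛ)

count-allFuns : ∀ k m (S : Fin k → Fin m → Bool) →
                count (λ f → allB (λ u → S u (f u))) (allFuns k m) ≡ product (tabulate (λ u → count (S u) (allFin m)))
count-allFuns zero    m S = refl
count-allFuns (suc k) m S =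
  trans (count-concatMap _ (λ i g → split _) (allFin m) (allFuns k m))
        (cong (count (S zero) (allFin m) *_) (count-allFuns k m (S ∘ suc)))
  where
  split : (f : Fin (suc k) → Fin m) →
          allB (λ u → S u (f u)) ≡ S zero (f zero) ∧ allB (λ u → S (suc u) (f (suc u)))
  split f = allB-suc (λ u → S u (f u))

isHomB⁻ : ∀ G H f → isHomB G H f ≡ true → IsHom G H f
isHomB⁻ G H f hom u v uv with adj G u v | allB⁻ (allB⁻ hom u) v
... | true | fufv = fufv

-- The implication inside isHomB is local to its definition and cannot be named here, so
-- instead of using allB⁺ we refute a failing pair (u, v).
isHomB⁺ : ∀ G H f → IsHom G H f → isHomB G H f ≡ true
isHomB⁺ G H f hom with isHomB G H f in eq
... | true  = refl
... | false with allB-counterexample eq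
...   | u , eqᵤ with allB-counterexample eqᵤ
...     | v , eqᵤᵥ with adj G u v | hom u v
...       | true  | fufv with trans (sym (fufv refl)) eqᵤᵥ
...         | ()
isHomB⁺ G H f hom | false | u , eqᵤ | v , () | false | _

-- Proper 2-colourings of connected graphs

ProperColouring : (G : Graph) → (Fin (n G) → Bool) → Set
ProperColouring G c = ∀ u v → Edge G u v → c u ≢ c v

walk-invariant : ∀ {G : Graph} {A : Set} (f : Fin (n G) → A) → (∀ u v → Edge G u v → f u ≡ f v) →
                 ∀ {u v ℓ} → Walk G u v ℓ → f u ≡ f v
walk-invariant f inv here           = refl
walk-invariant f inv (step uw walk) = trans (inv _ _ uw) (walk-invariant f inv walk)

-- Along an edge both colourings flip, so d xor c is constant on a connected graph.
proper-colouring-unique : ∀ {G} {c d : Fin (n G) → Bool} → Connected G →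
                          ProperColouring G c → ProperColouring G d →
                          ∀ u v → d v ≡ (d u xor c u) xor c v
proper-colouring-unique {G} {c} {d} conn c-proper d-proper u v = begin
  d v                     ≡⟨ sym (xor-cancelʳ (d v) (c v)) ⟩
  (d v xor c v) xor c v   ≡⟨ cong (_xor c v) (sym (walk-invariant twist flips (proj₂ (conn u v)))) ⟩
  (d u xor c u) xor c v   ∎
  where
  twist : Fin (n G) → Bool
  twist w = d w xor c w

  flips : ∀ w w′ → Edge G w w′ → twist w ≡ twist w′
  flips w w′ e = begin
    d w xor c w                   ≡⟨ sym (not-xor-not (d w) (c w)) ⟩
    not (d w) xor not (c w)       ≡⟨ sym (cong₂ _xor_ (¬-not (d-proper w w′ e ∘ sym)) (¬-not (c-proper w w′ e ∘ sym))) ⟩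
    d w′ xor c w′                 ∎

-- The path on three vertices, with centre 0

isCentre : Fin 3 → Bool
isCentre zero    = true
isCentre (suc _) = false

P3 : Graph
P3 = record { n = 3 ; adj = λ x y → isCentre x xor isCentre y ; sym = symmetric ; irrefl = λ x → xor-same (isCentre x) }
  where
  symmetric : ∀ x y → isCentre x xor isCentre y ≡ isCentre y xor isCentre x
  symmetric zero    zero    = refl
  symmetric zero    (suc _) = refl
  symmetric (suc _) zero    = refl
  symmetric (suc _) (suc _) = refl

P3-connected : Connected P3
P3-connected zero    zero    = 0 , here
P3-connected zero    (suc _) = 1 , step refl here
P3-connected (suc _) zero    = 1 , step refl here
P3-connected (suc _) (suc _) = 2 , step {w = zero} refl (step refl here)

-- Every edge of P3 joins the centre to a leaf, so a cycle x y z … would need y or else x and z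
-- to be the centre; both contradict the distinctness of its vertices.
P3-acyclic : ¬ HasCycle P3
P3-acyclic (_ , [] , _ , _ , () , _)
P3-acyclic (_ , _ ∷ [] , _ , _ , s≤s () , _)
P3-acyclic (zero , zero ∷ _ , cons () _ , _)
P3-acyclic (suc _ , suc _ ∷ _ , cons () _ , _)
P3-acyclic (_ , zero ∷ zero ∷ _ , cons _ (cons () _) , _)
P3-acyclic (_ , suc _ ∷ suc _ ∷ _ , cons _ (cons () _) , _)
P3-acyclic (zero , suc _ ∷ zero ∷ _ , _ , (_ ∷ x≢z ∷ _) ∷ _ , _)           = x≢z refl
P3-acyclic (suc _ , zero ∷ suc _ ∷ [] , _ , _ , _ , ())
P3-acyclic (suc _ , zero ∷ suc _ ∷ zero ∷ _ , _ , _ ∷ (_ ∷ y≢w ∷ _) ∷ _ , _) = y≢w refl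
P3-acyclic (suc _ , zero ∷ suc _ ∷ suc _ ∷ _ , cons _ (cons _ (cons () _)) , _)

P3-tree : IsTree P3
P3-tree = s≤s z≤n , P3-connected , P3-acyclic

-- Homomorphisms into P3

trues falses : ∀ {k} → (Fin k → Bool) → ℕ
trues  {zero}  c = 0
trues  {suc k} c = if c zero then suc (trues (c ∘ suc)) else trues (c ∘ suc)
falses {zero}  c = 0
falses {suc k} c = if c zero then falses (c ∘ suc) else suc (falses (c ∘ suc))

trues-not : ∀ {k} (c : Fin k → Bool) → trues (not ∘ c) ≡ falses c
trues-not {zero}  c = refl
trues-not {suc k} c with c zero
... | true  = trues-not (c ∘ suc)
... | false = cong suc (trues-not (c ∘ suc))

falses-not : ∀ {k} (c : Fin k → Bool) → falses (not ∘ c) ≡ trues c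
falses-not {zero}  c = refl
falses-not {suc k} c with c zero
... | true  = cong suc (falses-not (c ∘ suc))
... | false = falses-not (c ∘ suc)

sendsToCentre : ∀ {k} → (Fin k → Bool) → (Fin k → Fin 3) → Bool
sendsToCentre d f = allB (λ u → does (isCentre (f u) ≟ d u))

sendsToCentre⁻ : ∀ {k} (d : Fin k → Bool) f → sendsToCentre d f ≡ true → ∀ u → isCentre (f u) ≡ d u
sendsToCentre⁻ d f sends u = does-≟⇒ (allB⁻ sends u)

sendsToCentre⁺ : ∀ {k} (d : Fin k → Bool) f → (∀ u → isCentre (f u) ≡ d u) → sendsToCentre d f ≡ true
sendsToCentre⁺ d f sends = allB⁺ (λ u → dec-true (_ ≟ _) (sends u))

count-sendsToCentre : ∀ k (d : Fin k → Bool) → count (sendsToCentre d) (allFuns k 3) ≡ 2 ^ falses d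
count-sendsToCentre k d = begin
  count (sendsToCentre d) (allFuns k 3)
    ≡⟨ count-allFuns k 3 (λ u x → does (isCentre x ≟ d u)) ⟩
  product (tabulate (λ u → count (λ x → does (isCentre x ≟ d u)) (allFin 3)))
    ≡⟨ cong product (tabulate-cong (λ u → choices (d u))) ⟩
  product (tabulate (λ u → if d u then 1 else 2))
    ≡⟨ product-choices d ⟩
  2 ^ falses d ∎
  where
  choices : ∀ b → count (λ x → does (isCentre x ≟ b)) (allFin 3) ≡ (if b then 1 else 2)
  choices true  = refl
  choices false = refl

  product-choices : ∀ {k} (d : Fin k → Bool) → product (tabulate (λ u → if d u then 1 else 2)) ≡ 2 ^ falses d
  product-choices {zero}  d = refl
  product-choices {suc k} d with d zero
  ... | true  = trans (*-identityˡ _) (product-choices (d ∘ suc))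
  ... | false = cong (2 *_) (product-choices (d ∘ suc))

module _ (G : Graph) (c : Fin (n G) → Bool) (conn : Connected G) (c-proper : ProperColouring G c) where

  hom-P3-levels : ∀ f → IsHom G P3 f → ∀ u v → isCentre (f v) ≡ (isCentre (f u) xor c u) xor c v
  hom-P3-levels f hom = proper-colouring-unique conn c-proper (λ u v e → xor≡true⇒≢ (hom u v e))

  levels-hom-P3 : ∀ f k → (∀ u → isCentre (f u) ≡ k xor c u) → IsHom G P3 f
  levels-hom-P3 f k levels u v e = begin
    isCentre (f u) xor isCentre (f v)   ≡⟨ cong₂ _xor_ (levels u) (levels v) ⟩
    (k xor c u) xor (k xor c v)         ≡⟨ shift k ⟩
    c u xor c v                         ≡⟨ ≢⇒xor≡true (c-proper u v e) ⟩
    true                                ∎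
    where
    shift : ∀ k → (k xor c u) xor (k xor c v) ≡ c u xor c v
    shift true  = not-xor-not (c u) (c v)
    shift false = refl

  isHomB-P3 : ∀ u₀ f → isHomB G P3 f ≡ sendsToCentre c f ∨ sendsToCentre (not ∘ c) f
  isHomB-P3 u₀ f = ⇔→≡ (mk⇔ ⇒ ⇐)
    where
    ⇒ : isHomB G P3 f ≡ true → sendsToCentre c f ∨ sendsToCentre (not ∘ c) f ≡ true
    ⇒ hom with isCentre (f u₀) xor c u₀ | hom-P3-levels f (isHomB⁻ G P3 f hom) u₀
    ... | false | levels = cong (_∨ sendsToCentre (not ∘ c) f) (sendsToCentre⁺ c f levels)
    ... | true  | levels = trans (cong (sendsToCentre c f ∨_) (sendsToCentre⁺ (not ∘ c) f levels)) (∨-zeroʳ _)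

    ⇐ : sendsToCentre c f ∨ sendsToCentre (not ∘ c) f ≡ true → isHomB G P3 f ≡ true
    ⇐ sends with ∨≡true⇒ sends
    ... | inj₁ sends-c    = isHomB⁺ G P3 f (levels-hom-P3 f false (sendsToCentre⁻ c f sends-c))
    ... | inj₂ sends-notc = isHomB⁺ G P3 f (levels-hom-P3 f true (sendsToCentre⁻ (not ∘ c) f sends-notc))

  homCount-P3 : Fin (n G) → homCount G P3 ≡ 2 ^ falses c + 2 ^ trues c
  homCount-P3 u₀ = begin
    homCount G P3
      ≡⟨ count-cong (isHomB-P3 u₀) (allFuns (n G) 3) ⟩
    count (λ f → sendsToCentre c f ∨ sendsToCentre (not ∘ c) f) (allFuns (n G) 3)
      ≡⟨ count-∨ disjoint (allFuns (n G) 3) ⟩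
    count (sendsToCentre c) (allFuns (n G) 3) + count (sendsToCentre (not ∘ c)) (allFuns (n G) 3)
      ≡⟨ cong₂ _+_ (count-sendsToCentre (n G) c) (count-sendsToCentre (n G) (not ∘ c)) ⟩
    2 ^ falses c + 2 ^ falses (not ∘ c)
      ≡⟨ cong (λ m → 2 ^ falses c + 2 ^ m) (falses-not c) ⟩
    2 ^ falses c + 2 ^ trues c ∎
    where
    disjoint : ∀ f → sendsToCentre c f ≡ true → sendsToCentre (not ∘ c) f ≡ true → ⊥
    disjoint f sends-c sends-notc =
      not-¬ (sendsToCentre⁻ c f sends-c u₀) (sendsToCentre⁻ (not ∘ c) f sends-notc u₀)

-- Sums of two powers of two

2^-injective : ∀ {a b} → 2 ^ a ≡ 2 ^ b → a ≡ b
2^-injective {a} {b} 2^a≡2^b = begin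
  a              ≡⟨ sym (⌊log₂[2^n]⌋≡n a) ⟩
  ⌊log₂ 2 ^ a ⌋  ≡⟨ cong ⌊log₂_⌋ 2^a≡2^b ⟩
  ⌊log₂ 2 ^ b ⌋  ≡⟨ ⌊log₂[2^n]⌋≡n b ⟩
  b              ∎

2^a+2^b≢1 : ∀ a b → 2 ^ a + 2 ^ b ≢ 1
2^a+2^b≢1 a b sum≡1 with subst (2 ≤_) sum≡1 (+-mono-≤ (m^n>0 2 a) (m^n>0 2 b))
... | s≤s ()

halve : ∀ w x y z → 2 * w + 2 * x ≡ 2 * y + 2 * z → w + x ≡ y + z
halve w x y z e = *-cancelˡ-≡ (w + x) (y + z) 2 (begin
  2 * (w + x)      ≡⟨ *-distribˡ-+ 2 w x ⟩
  2 * w + 2 * x    ≡⟨ e ⟩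
  2 * y + 2 * z    ≡⟨ sym (*-distribˡ-+ 2 y z) ⟩
  2 * (y + z)      ∎)

-- The left side is odd unless b = 0, in which case it is 2 while the right side is at least 4.
1+2^b≢2^[1+c]+2^[1+d] : ∀ b c d → 1 + 2 ^ b ≢ 2 ^ suc c + 2 ^ suc d
1+2^b≢2^[1+c]+2^[1+d] zero    c d e = 2^a+2^b≢1 c d (sym (halve 1 0 (2 ^ c) (2 ^ d) e))
1+2^b≢2^[1+c]+2^[1+d] (suc b) c d e =
  even≢odd (2 ^ c + 2 ^ d) (2 ^ b) (sym (trans e (sym (*-distribˡ-+ 2 (2 ^ c) (2 ^ d)))))

2^a+2^b-injective-sorted : ∀ {a b c d} → a ≤ b → c ≤ d → 2 ^ a + 2 ^ b ≡ 2 ^ c + 2 ^ d → a ≡ c × b ≡ d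
2^a+2^b-injective-sorted {zero}  {b}     {zero}  {d}     _         _         e = refl , 2^-injective (suc-injective e)
2^a+2^b-injective-sorted {zero}  {b}     {suc c} {suc d} _         _         e = ⊥-elim (1+2^b≢2^[1+c]+2^[1+d] b c d e)
2^a+2^b-injective-sorted {suc a} {suc b} {zero}  {d}     _         _         e = ⊥-elim (1+2^b≢2^[1+c]+2^[1+d] d a b (sym e))
2^a+2^b-injective-sorted {suc a} {suc b} {suc c} {suc d} (s≤s a≤b) (s≤s c≤d) e =
  Product.map (cong suc) (cong suc) (2^a+2^b-injective-sorted a≤b c≤d (halve (2 ^ a) (2 ^ b) (2 ^ c) (2 ^ d) e))

2^a+2^b-injective : ∀ a b c d → 2 ^ a + 2 ^ b ≡ 2 ^ c + 2 ^ d → (a ≡ c × b ≡ d) ⊎ (a ≡ d × b ≡ c)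
2^a+2^b-injective a b c d e with ≤-total a b | ≤-total c d
... | inj₁ a≤b | inj₁ c≤d = inj₁ (2^a+2^b-injective-sorted a≤b c≤d e)
... | inj₁ a≤b | inj₂ d≤c = inj₂ (2^a+2^b-injective-sorted a≤b d≤c (trans e (+-comm (2 ^ c) (2 ^ d))))
... | inj₂ b≤a | inj₁ c≤d = inj₂ (swap (2^a+2^b-injective-sorted b≤a c≤d (trans (+-comm (2 ^ b) (2 ^ a)) e)))
... | inj₂ b≤a | inj₂ d≤c =
  inj₁ (swap (2^a+2^b-injective-sorted b≤a d≤c (trans (+-comm (2 ^ b) (2 ^ a)) (trans e (+-comm (2 ^ c) (2 ^ d))))))

-- Complete bipartite graphs

complete-bipartite : ∀ G (c : Fin (n G) → Bool) → ProperColouring G c → DiamLe2 G →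
                     ∀ u v → adj G u v ≡ c u xor c v
complete-bipartite G c c-proper diam u v with adj G u v in uv
... | true  = sym (≢⇒xor≡true (c-proper u v uv))
... | false with c u ≟ c v
...   | yes cu≡cv = sym (trans (cong (c u xor_) (sym cu≡cv)) (xor-same (c u)))
...   | no  cu≢cv with diam u v (cu≢cv ∘ cong c)
...     | inj₁ uv′ with trans (sym uv′) uv
...       | ()
complete-bipartite G c c-proper diam u v | false | no cu≢cv | inj₂ (w , uw , wv) =
  ⊥-elim (cu≢cv (trans (¬-not (c-proper u w uw)) (trans (cong not (¬-not (c-proper w v wv))) (not-involutive (c v)))))

isLeft : {A B : Set} → A ⊎ B → Bool
isLeft (inj₁ _) = true
isLeft (inj₂ _) = false

-- One step of colourClasses: vertex 0 goes to the front of the class of colour b.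
module _ {k P Q : ℕ} where

  splitCons : (b : Bool) → (Fin k → Fin P ⊎ Fin Q) →
              Fin (suc k) → Fin (if b then suc P else P) ⊎ Fin (if b then Q else suc Q)
  splitCons true  s zero    = inj₁ zero
  splitCons true  s (suc u) = map₁ suc (s u)
  splitCons false s zero    = inj₂ zero
  splitCons false s (suc u) = map₂ suc (s u)

  mergeCons : (b : Bool) → (Fin P ⊎ Fin Q → Fin k) →
              Fin (if b then suc P else P) ⊎ Fin (if b then Q else suc Q) → Fin (suc k)
  mergeCons true  m (inj₁ zero)    = zero
  mergeCons true  m (inj₁ (suc x)) = suc (m (inj₁ x))
  mergeCons true  m (inj₂ y)       = suc (m (inj₂ y))
  mergeCons false m (inj₁ x)       = suc (m (inj₁ x))
  mergeCons false m (inj₂ zero)    = zero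
  mergeCons false m (inj₂ (suc y)) = suc (m (inj₂ y))

  mergeCons∘splitCons : ∀ b {s m} → (∀ u → m (s u) ≡ u) → ∀ u → mergeCons b m (splitCons b s u) ≡ u
  mergeCons∘splitCons true      ms zero    = refl
  mergeCons∘splitCons false     ms zero    = refl
  mergeCons∘splitCons true  {s} ms (suc u) with s u | ms u
  ... | inj₁ _ | msu = cong suc msu
  ... | inj₂ _ | msu = cong suc msu
  mergeCons∘splitCons false {s} ms (suc u) with s u | ms u
  ... | inj₁ _ | msu = cong suc msu
  ... | inj₂ _ | msu = cong suc msu

  splitCons∘mergeCons : ∀ b {s m} → (∀ x → s (m x) ≡ x) → ∀ x → splitCons b s (mergeCons b m x) ≡ x
  splitCons∘mergeCons true  sm (inj₁ zero)    = refl
  splitCons∘mergeCons true  sm (inj₁ (suc x)) = cong (map₁ suc) (sm (inj₁ x))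
  splitCons∘mergeCons true  sm (inj₂ y)       = cong (map₁ suc) (sm (inj₂ y))
  splitCons∘mergeCons false sm (inj₁ x)       = cong (map₂ suc) (sm (inj₁ x))
  splitCons∘mergeCons false sm (inj₂ zero)    = refl
  splitCons∘mergeCons false sm (inj₂ (suc y)) = cong (map₂ suc) (sm (inj₂ y))

  isLeft-splitCons : ∀ (c : Fin (suc k) → Bool) {s} → (∀ u → isLeft (s u) ≡ c (suc u)) →
                     ∀ u → isLeft (splitCons (c zero) s u) ≡ c u
  isLeft-splitCons c {s} colour u with c zero in c₀
  isLeft-splitCons c {s} colour zero    | true  = sym c₀
  isLeft-splitCons c {s} colour zero    | false = sym c₀
  isLeft-splitCons c {s} colour (suc u) | true  with s u | colour u
  ... | inj₁ _ | cu = cu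
  ... | inj₂ _ | cu = cu
  isLeft-splitCons c {s} colour (suc u) | false with s u | colour u
  ... | inj₁ _ | cu = cu
  ... | inj₂ _ | cu = cu

colourClasses : ∀ {k} (c : Fin k → Bool) →
                Σ (Fin k ↔ (Fin (trues c) ⊎ Fin (falses c))) λ σ → ∀ u → isLeft (to σ u) ≡ c u
colourClasses {zero}  c = mk↔ₛ′ (λ ()) (λ { (inj₁ ()) ; (inj₂ ()) }) (λ { (inj₁ ()) ; (inj₂ ()) }) (λ ()) , λ ()
colourClasses {suc k} c with colourClasses (c ∘ suc)
... | σ , colour =
  mk↔ₛ′ (splitCons (c zero) (to σ)) (mergeCons (c zero) (from σ))
        (splitCons∘mergeCons (c zero) (strictlyInverseˡ σ)) (mergeCons∘splitCons (c zero) (strictlyInverseʳ σ))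
  , isLeft-splitCons c colour

SameClassSizes : ∀ {k k′} → (Fin k → Bool) → (Fin k′ → Bool) → Set
SameClassSizes c c′ = trues c ≡ trues c′ × falses c ≡ falses c′

colour-preserving-bijection : ∀ {k k′} (c : Fin k → Bool) (c′ : Fin k′ → Bool) → SameClassSizes c c′ →
                              Σ (Fin k ↔ Fin k′) λ σ → ∀ u → c′ (to σ u) ≡ c u
colour-preserving-bijection {k′ = k′} c c′ (trues≡ , falses≡)
  with colourClasses c
     | subst₂ (λ P Q → Σ (Fin k′ ↔ (Fin P ⊎ Fin Q)) λ τ → ∀ u → isLeft (to τ u) ≡ c′ u)
              (sym trues≡) (sym falses≡) (colourClasses c′)
... | σ , σ-colour | τ , τ-colour = ↔-trans σ (↔-sym τ) , λ u → begin
  c′ (from τ (to σ u))             ≡⟨ sym (τ-colour (from τ (to σ u))) ⟩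
  isLeft (to τ (from τ (to σ u)))  ≡⟨ cong isLeft (strictlyInverseˡ τ (to σ u)) ⟩
  isLeft (to σ u)                  ≡⟨ σ-colour u ⟩
  c u                              ∎

xor-graphs-isomorphic : ∀ G H (cG : Fin (n G) → Bool) (cH : Fin (n H) → Bool) →
                        (∀ u v → adj G u v ≡ cG u xor cG v) → (∀ u v → adj H u v ≡ cH u xor cH v) →
                        (σ : Fin (n G) ↔ Fin (n H)) → (∀ u → cH (to σ u) ≡ cG u) → Isomorphic G H
xor-graphs-isomorphic G H cG cH adjG adjH σ σ-colour = σ , λ u v → begin
  adj G u v                          ≡⟨ adjG u v ⟩
  cG u xor cG v                      ≡⟨ sym (cong₂ _xor_ (σ-colour u) (σ-colour v)) ⟩
  cH (to σ u) xor cH (to σ v)        ≡⟨ sym (adjH (to σ u) (to σ v)) ⟩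
  adj H (to σ u) (to σ v)            ∎

complete-bipartite-isomorphic : ∀ G H (cG : Fin (n G) → Bool) (cH : Fin (n H) → Bool) →
                                (∀ u v → adj G u v ≡ cG u xor cG v) → (∀ u v → adj H u v ≡ cH u xor cH v) →
                                SameClassSizes cG cH ⊎ SameClassSizes cG (not ∘ cH) → Isomorphic G H
complete-bipartite-isomorphic G H cG cH adjG adjH (inj₁ same) =
  Product.uncurry (xor-graphs-isomorphic G H cG cH adjG adjH) (colour-preserving-bijection cG cH same)
complete-bipartite-isomorphic G H cG cH adjG adjH (inj₂ swapped) =
  Product.uncurry (xor-graphs-isomorphic G H cG (not ∘ cH) adjG adjH′) (colour-preserving-bijection cG (not ∘ cH) swapped)
  where
  adjH′ : ∀ u v → adj H u v ≡ not (cH u) xor not (cH v)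
  adjH′ u v = trans (adjH u v) (sym (not-xor-not (cH u) (cH v)))

-- The empty graph has a single homomorphism into P3, the empty map, whereas 2^a + 2^b ≥ 2.
P3-count-determines-class-sizes :
  ∀ G H (cG : Fin (n G) → Bool) (cH : Fin (n H) → Bool) →
  Connected G → ProperColouring G cG → Connected H → ProperColouring H cH →
  homCount G P3 ≡ homCount H P3 → SameClassSizes cG cH ⊎ SameClassSizes cG (not ∘ cH)
P3-count-determines-class-sizes record { n = zero } record { n = zero } _ _ _ _ _ _ _ = inj₁ (refl , refl)
P3-count-determines-class-sizes record { n = zero } H@record { n = suc _ } _ cH _ _ connH properH same =
  ⊥-elim (2^a+2^b≢1 (falses cH) (trues cH) (trans (sym (homCount-P3 H cH connH properH zero)) (sym same)))
P3-count-determines-class-sizes G@record { n = suc _ } record { n = zero } cG _ connG properG _ _ same =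
  ⊥-elim (2^a+2^b≢1 (falses cG) (trues cG) (trans (sym (homCount-P3 G cG connG properG zero)) same))
P3-count-determines-class-sizes G@record { n = suc _ } H@record { n = suc _ } cG cH connG properG connH properH same
  with 2^a+2^b-injective (falses cG) (trues cG) (falses cH) (trues cH)
         (trans (sym (homCount-P3 G cG connG properG zero)) (trans same (homCount-P3 H cH connH properH zero)))
... | inj₁ (falses≡ , trues≡) = inj₁ (trues≡ , falses≡)
... | inj₂ (falses≡trues , trues≡falses) =
  inj₂ (trans trues≡falses (sym (trues-not cH)) , trans falses≡trues (sym (falses-not cH)))

mainTheorem2 : (G H : Graph) →
    Bipartite G → DiamLe2 G → Connected G →
    Bipartite H → DiamLe2 H → Connected H →
    ((T : Graph) → IsTree T → homCount G T ≡ homCount H T) →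
    Isomorphic G H
mainTheorem2 G H (cG , properG) diamG connG (cH , properH) diamH connH same =
  complete-bipartite-isomorphic G H cG cH
    (complete-bipartite G cG properG diamG) (complete-bipartite H cH properH diamH)
    (P3-count-determines-class-sizes G H cG cH connG properG connH properH (same P3 P3-tree))
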